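{- Let $S$ be an instance of Max $r(n)$-Lin-2 AA (with parameter $k$) that is irreducible by the combining rule, i.e., no two distinct equations of $S$ have the same variable set $\alpha_j$. If Algorithm $\mathcal{A}$, run on $S$, marks $k$ equations, then $S$ is a YES-instance.
   Context: Max $r(n)$-Lin-2 AA ($r=r(n)$ a fixed function): an instance is a system $S$ of $m$ linear equations over $\mathbb{F}_2$ in variables $z_1,\dots,z_n$, Equation $j$ being $\sum_{i\in\alpha_j} z_i = b_j$ with $\emptyset\neq\alpha_j\subseteq\{1,\dots,n\}$, $|\alpha_j|\le r$, $b_j\in\mathbb{F}_2$, and a positive integer weight $w_j$; together with a nonnegative integer parameter $k$. It is assumed each variable appears in at least one equation. Let $W=w_1+\dots+w_m$. The instance is a YES-instance if some assignment to $z_1,\dots,z_n$ satisfies equations of total weight at least $(W+k)/2$. Combining rule: if there are two equations $\sum_{i\in\alpha}z_i=b'$ (weight $w'$) and $\sum_{i\in\alpha}z_i=b''$ (weight $w''$) with the same set $\alpha$, replace the pair by one equation with weight $w'+w''$ if $b'=b''$, and otherwise by the equation of larger weight with new weight equal to the difference of the two weights; an equation whose resulting weight is $0$ is deleted. Algorithm $\mathcal{A}$ (initially nothing is marked): while $S\neq\emptyset$ and fewer than $k$ equations are marked, do: (1) for each $i$ compute $\rho_i$, the number of equations of the current $S$ containing $z_i$; (2) choose a variable $z_l$ still occurring in $S$ with minimum $\rho_l$ and mark it; (3) choose an arbitrary equation $\sum_{i\in\alpha}z_i=b$ containing $z_l$; (4) mark this equation and delete it from $S$; (5) replace every remaining equation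 $\sum_{i\in\alpha'}z_i=b'$ of $S$ containing $z_l$ by $\sum_{i\in\alpha\,\Delta\,\alpha'}z_i=b+b'$ (keeping its weight); (6) apply the combining rule exhaustively. -}

module Defs where

open import Data.Bool using (Bool; true; false; _xor_; _∧_; if_then_else_; T?)
open import Data.Nat using (ℕ; zero; suc; _+_; _*_; _∸_; _≤_; _<_; _<ᵇ_)
open import Data.Fin using (Fin)
open import Data.Fin.Subset using (Subset; _∈_; ∣_∣; Nonempty)
open import Data.Vec using (Vec; lookup; zipWith; tabulate; foldr′)
open import Data.List using (List; []; _∷_; _++_; map; filter; length)
open import Data.Nat.ListAction using (sum)
open import Data.List.Relation.Unary.All using (All)
open import Data.List.Relation.Unary.Any using (Any)
open import Data.List.Relation.Unary.AllPairs using (AllPairs)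
open import Data.List.Relation.Binary.Permutation.Propositional using (_↭_)
open import Relation.Binary.Construct.Closure.ReflexiveTransitive using (Star)
open import Relation.Binary.PropositionalEquality using (_≡_; _≢_)
open import Relation.Nullary using (¬_)
open import Data.Product using (Σ; ∃; _×_)

-- An equation  Σ_{i ∈ α} z_i = b  with weight w, over variables z_0 … z_{n-1}.
record Eqn (n : ℕ) : Set where
  constructor eqn
  field
    α : Subset n
    b : Bool
    w : ℕ
open Eqn public

System : ℕ → Set
System n = List (Eqn n)

occurs : ∀ {n} → Fin n → Eqn n → Bool
occurs i e = lookup (α e) i

lhs : ∀ {n} → (Fin n → Bool) → Subset n → Bool
lhs x a = foldr′ _xor_ false (tabulate (λ i → lookup a i ∧ x i))

satisfies : ∀ {n} → (Fin n → Bool) → Eqn n → Bool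
satisfies x e = if lhs x (α e) xor b e then false else true

totalWeight : ∀ {n} → System n → ℕ
totalWeight S = sum (map w S)

satWeight : ∀ {n} → (Fin n → Bool) → System n → ℕ
satWeight x S = sum (map (λ e → if satisfies x e then w e else 0) S)

record ValidInstance (r : ℕ → ℕ) (n : ℕ) (S : System n) : Set where
  field
    nonemptySets : All (λ e → Nonempty (α e)) S
    boundedSets  : All (λ e → ∣ α e ∣ ≤ r n) S
    posWeights   : All (λ e → 0 < w e) S
    everyVarOccurs : ∀ (i : Fin n) → Any (λ e → i ∈ α e) S

-- YES-instance: some assignment satisfies weight ≥ (W + k)/2, i.e. 2·sat ≥ W + k.
YesInstance : ∀ {n} → System n → ℕ → Set
YesInstance {n} S k = ∃ λ (x : Fin n → Bool) → totalWeight S + k ≤ 2 * satWeight x S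

Irreducible : ∀ {n} → System n → Set
Irreducible S = AllPairs (λ e e′ → α e ≢ α e′) S

combine : ∀ {n} → Eqn n → Eqn n → List (Eqn n)
combine (eqn a b₁ w₁) (eqn _ b₂ w₂) =
  if b₁ xor b₂
  then (if w₂ <ᵇ w₁ then eqn a b₁ (w₁ ∸ w₂) ∷ []
        else if w₁ <ᵇ w₂ then eqn a b₂ (w₂ ∸ w₁) ∷ []
        else [])
  else eqn a b₁ (w₁ + w₂) ∷ []

data CombineStep {n : ℕ} : System n → System n → Set where
  combineStep : ∀ {S e₁ e₂ rest} → S ↭ (e₁ ∷ e₂ ∷ rest) → α e₁ ≡ α e₂ →
                CombineStep S (combine e₁ e₂ ++ rest)

CombineExhaustive : ∀ {n} → System n → System n → Set
CombineExhaustive S S′ = Star CombineStep S S′ × Irreducible S′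

ρ : ∀ {n} → System n → Fin n → ℕ
ρ S i = length (filter (λ e → T? (occurs i e)) S)

_Δ_ : ∀ {n} → Subset n → Subset n → Subset n
a Δ a′ = zipWith _xor_ a a′

eliminate : ∀ {n} → Fin n → Eqn n → Eqn n → Eqn n
eliminate l e e′ =
  if occurs l e′ then eqn (α e Δ α e′) (b e xor b e′) (w e′) else e′

data AStep {n : ℕ} : System n → System n → Set where
  aStep : ∀ {S} (l : Fin n) (e : Eqn n) (rest : System n) {S′ : System n} →
          0 < ρ S l →
          (∀ (i : Fin n) → 0 < ρ S i → ρ S l ≤ ρ S i) →
          l ∈ α e →
          S ↭ (e ∷ rest) →
          CombineExhaustive (map (eliminate l e) rest) S′ →
          AStep S S′

-- AStepsₖ S S′ : Algorithm A performs exactly k iterations (marking k equations)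
-- going from S to S′.  (Each iteration requires S nonempty, and the loop guard
-- "fewer than k marked" holds before each of these k iterations.)
data ASteps {n : ℕ} : ℕ → System n → System n → Set where
  done : ∀ {S} → ASteps zero S S
  step : ∀ {k S S′ S″} → AStep S S′ → ASteps k S′ S″ → ASteps (suc k) S S″

-- Measure an assignment x by its excess, the weight of the equations x satisfies minus the
-- weight of those it violates: S is a YES-instance iff some x has excess at least k.
-- Combining never changes the excess of any assignment.  An iteration of Algorithm A marks
-- an equation e containing z_l and eliminates z_l from all other equations, so afterwards z_l
-- occurs nowhere and can be chosen to satisfy e without affecting the rest; every iteration
-- thus adds w(e) ≥ 1 to the excess.  Irreducibility ensures that elimination never produces
-- an empty left-hand side, and a system without empty left-hand sides has an assignment of
-- excess ≥ 0 (conditional expectations: fix the variables one at a time, each time keeping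
-- the better of the two halves).
module Submission where

open import Algebra using (CommutativeRing; AbelianGroup)
open import Data.Bool using (Bool; true; false; not; _∧_; _xor_; if_then_else_)
open import Data.Bool.Properties
  using (xor-∧-commutativeRing; xor-comm; xor-assoc; xor-identityʳ; ∧-distribʳ-xor;
         not-distribˡ-xor; not-distribʳ-xor)
open import Data.Fin using (Fin; zero; suc)
open import Data.Fin.Subset using (Subset; Nonempty)
open import Data.Integer using (ℤ; +_; -_; 0ℤ; _-_; +≤+)
  renaming (_+_ to _+ℤ_; _≤_ to _≤ℤ_)
import Data.Integer.Properties as ℤ
open import Data.List using ([]; _∷_; _++_; map)
open import Data.List.Relation.Unary.All as All using (All; []; _∷_)
open import Data.List.Relation.Unary.All.Properties using (++⁺; map⁺)
import Data.List.Relation.Unary.AllPairs as AllPairs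
open import Data.List.Relation.Binary.Permutation.Propositional as ↭ using (_↭_; ↭⇒↭ₛ)
open import Data.List.Relation.Binary.Permutation.Propositional.Properties using (All-resp-↭)
import Data.List.Relation.Binary.Permutation.Setoid.Properties as PermutationProperties
open import Data.Nat using (ℕ; zero; suc; _+_; _*_; _∸_; _≤_; _<_; _<ᵇ_)
import Data.Nat.Properties as ℕ
open import Data.Product using (∃; _×_; _,_; proj₁; proj₂)
import Data.Product as Product
open import Data.Sum using (_⊎_; inj₁; inj₂; [_,_]′)
open import Data.Vec using ([]; _∷_; lookup; here; there)
open import Data.Vec.Functional as Vector using (Vector)
open import Data.Vec.Properties using (lookup-zipWith; []=⇒lookup)
open import Function using (_∘_; id)
open import Relation.Binary.Construct.Closure.ReflexiveTransitive using (Star; fold)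
open import Relation.Binary.PropositionalEquality
  using (_≡_; _≢_; refl; sym; trans; cong; cong₂; ≢-sym; resp₂; setoid; module ≡-Reasoning)
open import Relation.Nullary using (ofʸ; ofⁿ; contradiction)

open import Algebra.Properties.CommutativeSemigroup
  (CommutativeRing.+-commutativeSemigroup xor-∧-commutativeRing)
  using () renaming (interchange to xor-interchange; xy∙z≈y∙xz to xor-rotate)
open import Algebra.Properties.CommutativeSemigroup ℤ.+-commutativeSemigroup
  using () renaming (interchange to +-interchange; x∙yz≈y∙xz to +-exchange)
open import Algebra.Properties.AbelianGroup ℤ.+-0-abelianGroup
  using () renaming (⁻¹-anti-homo‿- to neg-anti-homo-)
open import Algebra.Properties.Group (AbelianGroup.group ℤ.+-0-abelianGroup)
  using (\\-leftDividesʳ)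

open import Defs

private
  variable
    n : ℕ

lhs-Δ : (x : Vector Bool n) (a a′ : Subset n) → lhs x (a Δ a′) ≡ lhs x a xor lhs x a′
lhs-Δ x []      []       = refl
lhs-Δ x (p ∷ a) (q ∷ a′) = begin
  ((p xor q) ∧ x₀) xor lhs x₊ (a Δ a′)
    ≡⟨ cong₂ _xor_ (∧-distribʳ-xor x₀ p q) (lhs-Δ x₊ a a′) ⟩
  ((p ∧ x₀) xor (q ∧ x₀)) xor (lhs x₊ a xor lhs x₊ a′)
    ≡⟨ xor-interchange (p ∧ x₀) (q ∧ x₀) (lhs x₊ a) (lhs x₊ a′) ⟩
  ((p ∧ x₀) xor lhs x₊ a) xor ((q ∧ x₀) xor lhs x₊ a′) ∎
  where
  open ≡-Reasoning
  x₀ = Vector.head x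
  x₊ = Vector.tail x

flipAt : Fin n → Vector Bool n → Vector Bool n
flipAt zero    x = not (Vector.head x) Vector.∷ Vector.tail x
flipAt (suc l) x = Vector.head x Vector.∷ flipAt l (Vector.tail x)

lhs-flipAt : (l : Fin n) (x : Vector Bool n) (a : Subset n) →
             lhs (flipAt l x) a ≡ lhs x a xor lookup a l
lhs-flipAt zero    x (false ∷ a) = sym (xor-identityʳ _)
lhs-flipAt zero    x (true ∷ a)  = sym (trans (xor-comm _ true) (not-distribˡ-xor (x zero) _))
lhs-flipAt (suc l) x (p ∷ a)     =
  trans (cong ((p ∧ x zero) xor_) (lhs-flipAt l (Vector.tail x) a))
        (sym (xor-assoc (p ∧ x zero) (lhs (Vector.tail x) a) (lookup a l)))

-- satisfies x e unfolds to holds (lhs x (α e) xor b e).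
holds : Bool → Bool
holds v = if v then false else true

holds-not : ∀ v → holds (not v) ≡ not (holds v)
holds-not true  = refl
holds-not false = refl

holds⇒false : ∀ {v} → holds v ≡ true → v ≡ false
holds⇒false {false} _ = refl

satisfies-not : (x : Vector Bool n) (a : Subset n) (c : Bool) (v v′ : ℕ) →
                satisfies x (eqn a (not c) v) ≡ not (satisfies x (eqn a c v′))
satisfies-not x a c _ _ =
  trans (cong holds (sym (not-distribʳ-xor (lhs x a) c))) (holds-not (lhs x a xor c))

satisfies-flipAt : (l : Fin n) (x : Vector Bool n) (e : Eqn n) → occurs l e ≡ true →
                   satisfies (flipAt l x) e ≡ not (satisfies x e)
satisfies-flipAt l x e l∈e = begin
  holds (lhs (flipAt l x) (α e) xor b e)  ≡⟨ cong (λ v → holds (v xor b e)) flipped ⟩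
  holds (not (lhs x (α e)) xor b e)       ≡⟨ cong holds (not-distribˡ-xor (lhs x (α e)) (b e)) ⟨
  holds (not (lhs x (α e) xor b e))       ≡⟨ holds-not (lhs x (α e) xor b e) ⟩
  not (satisfies x e)                     ∎
  where
  open ≡-Reasoning
  flipped : lhs (flipAt l x) (α e) ≡ not (lhs x (α e))
  flipped = trans (lhs-flipAt l x (α e))
                  (trans (cong (lhs x (α e) xor_) l∈e) (xor-comm (lhs x (α e)) true))

satisfies-flipAt-unoccurring : (l : Fin n) (x : Vector Bool n) (e : Eqn n) →
                               occurs l e ≡ false → satisfies (flipAt l x) e ≡ satisfies x e
satisfies-flipAt-unoccurring l x e l∉e =
  cong (λ v → holds (v xor b e))
       (trans (lhs-flipAt l x (α e))
              (trans (cong (lhs x (α e) xor_) l∉e) (xor-identityʳ (lhs x (α e)))))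

satisfies-eliminate : (y : Vector Bool n) (l : Fin n) (e e′ : Eqn n) → satisfies y e ≡ true →
                      satisfies y (eliminate l e e′) ≡ satisfies y e′
satisfies-eliminate y l e e′ e-holds with occurs l e′
... | false = refl
... | true  = cong holds (begin
  lhs y (α e Δ α e′) xor (b e xor b e′)
    ≡⟨ cong (_xor (b e xor b e′)) (lhs-Δ y (α e) (α e′)) ⟩
  (lhs y (α e) xor lhs y (α e′)) xor (b e xor b e′)
    ≡⟨ xor-interchange (lhs y (α e)) (lhs y (α e′)) (b e) (b e′) ⟩
  (lhs y (α e) xor b e) xor (lhs y (α e′) xor b e′)
    ≡⟨ cong (_xor (lhs y (α e′) xor b e′)) (holds⇒false e-holds) ⟩
  lhs y (α e′) xor b e′ ∎)
  where open ≡-Reasoning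

-- Excess

signed : Bool → ℕ → ℤ
signed true  v = + v
signed false v = - + v

signed-not : ∀ s v → signed (not s) v ≡ - signed s v
signed-not true  v = refl
signed-not false v = sym (ℤ.neg-involutive (+ v))

signed-+ : ∀ s u v → signed s (u + v) ≡ signed s u +ℤ signed s v
signed-+ true  u v = refl
signed-+ false u v = ℤ.neg-distrib-+ (+ u) (+ v)

signed-∸ : ∀ s {u v} → v ≤ u → signed s (u ∸ v) ≡ signed s u - signed s v
signed-∸ true  {u} {v} v≤u = sym (trans (ℤ.m-n≡m⊖n u v) (ℤ.⊖-≥ v≤u))
signed-∸ false {u} {v} v≤u =
  trans (cong -_ (signed-∸ true v≤u)) (ℤ.neg-distrib-+ (+ u) (- + v))

contribution : Vector Bool n → Eqn n → ℤ
contribution x e = signed (satisfies x e) (w e)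

excess : Vector Bool n → System n → ℤ
excess x []      = 0ℤ
excess x (e ∷ S) = contribution x e +ℤ excess x S

excess-++ : (x : Vector Bool n) (S T : System n) →
            excess x (S ++ T) ≡ excess x S +ℤ excess x T
excess-++ x []      T = sym (ℤ.+-identityˡ _)
excess-++ x (e ∷ S) T =
  trans (cong (contribution x e +ℤ_) (excess-++ x S T))
        (sym (ℤ.+-assoc (contribution x e) (excess x S) (excess x T)))

excess-↭ : (x : Vector Bool n) {S T : System n} → S ↭ T → excess x S ≡ excess x T
excess-↭ x ↭.refl          = refl
excess-↭ x (↭.prep e p)    = cong (contribution x e +ℤ_) (excess-↭ x p)
excess-↭ x (↭.swap e e′ p) =
  trans (cong (λ E → contribution x e +ℤ (contribution x e′ +ℤ E)) (excess-↭ x p))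
        (+-exchange (contribution x e) (contribution x e′) _)
excess-↭ x (↭.trans p q)   = trans (excess-↭ x p) (excess-↭ x q)

totalWeight+excess : (x : Vector Bool n) (S : System n) →
                     + totalWeight S +ℤ excess x S ≡ + satWeight x S +ℤ + satWeight x S
totalWeight+excess x []      = refl
totalWeight+excess x (e ∷ S) = begin
  (+ w e +ℤ + totalWeight S) +ℤ (contribution x e +ℤ excess x S)
    ≡⟨ +-interchange (+ w e) (+ totalWeight S) (contribution x e) (excess x S) ⟩
  (+ w e +ℤ contribution x e) +ℤ (+ totalWeight S +ℤ excess x S)
    ≡⟨ cong₂ _+ℤ_ weight+contribution (totalWeight+excess x S) ⟩
  (+ v +ℤ + v) +ℤ (+ satWeight x S +ℤ + satWeight x S)
    ≡⟨ +-interchange (+ v) (+ v) (+ satWeight x S) (+ satWeight x S) ⟩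
  (+ v +ℤ + satWeight x S) +ℤ (+ v +ℤ + satWeight x S) ∎
  where
  open ≡-Reasoning
  v : ℕ
  v = if satisfies x e then w e else 0
  weight+contribution : + w e +ℤ contribution x e ≡ + v +ℤ + v
  weight+contribution with satisfies x e
  ... | true  = refl
  ... | false = ℤ.+-inverseʳ (+ w e)

-- The combining rule preserves the excess

-- What combine (eqn a c w₁) (eqn _ (not c) w₂) unfolds to, for c = true and c = false.
combineOpposite : Subset n → Bool → ℕ → ℕ → System n
combineOpposite a c w₁ w₂ =
  if w₂ <ᵇ w₁ then eqn a c (w₁ ∸ w₂) ∷ []
  else if w₁ <ᵇ w₂ then eqn a (not c) (w₂ ∸ w₁) ∷ []
  else []

excess-combineOpposite : (x : Vector Bool n) (a : Subset n) (c : Bool) (w₁ w₂ : ℕ) →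
  excess x (combineOpposite a c w₁ w₂) ≡
  contribution x (eqn a c w₁) +ℤ contribution x (eqn a (not c) w₂)
excess-combineOpposite x a c w₁ w₂ = trans difference (sym contributions)
  where
  open ≡-Reasoning
  s = satisfies x (eqn a c w₁)
  s′ = satisfies x (eqn a (not c) w₂)
  s′≡not-s : s′ ≡ not s
  s′≡not-s = satisfies-not x a c w₂ w₁
  contributions : contribution x (eqn a c w₁) +ℤ contribution x (eqn a (not c) w₂) ≡
                  signed s w₁ - signed s w₂
  contributions =
    cong (signed s w₁ +ℤ_) (trans (cong (λ t → signed t w₂) s′≡not-s) (signed-not s w₂))
  difference : excess x (combineOpposite a c w₁ w₂) ≡ signed s w₁ - signed s w₂
  difference with w₂ <ᵇ w₁ | ℕ.<ᵇ-reflects-< w₂ w₁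
  ... | true  | ofʸ w₂<w₁ = trans (ℤ.+-identityʳ _) (signed-∸ s (ℕ.<⇒≤ w₂<w₁))
  ... | false | ofⁿ w₂≮w₁ with w₁ <ᵇ w₂ | ℕ.<ᵇ-reflects-< w₁ w₂
  ...   | true  | ofʸ w₁<w₂ = begin
    signed s′ (w₂ ∸ w₁) +ℤ 0ℤ      ≡⟨ ℤ.+-identityʳ _ ⟩
    signed s′ (w₂ ∸ w₁)            ≡⟨ cong (λ t → signed t (w₂ ∸ w₁)) s′≡not-s ⟩
    signed (not s) (w₂ ∸ w₁)       ≡⟨ signed-not s (w₂ ∸ w₁) ⟩
    - signed s (w₂ ∸ w₁)           ≡⟨ cong -_ (signed-∸ s (ℕ.<⇒≤ w₁<w₂)) ⟩
    - (signed s w₂ - signed s w₁)  ≡⟨ neg-anti-homo- (signed s w₂) (signed s w₁) ⟩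
    signed s w₁ - signed s w₂      ∎
  ...   | false | ofⁿ w₁≮w₂
    rewrite ℕ.≤-antisym (ℕ.≮⇒≥ w₂≮w₁) (ℕ.≮⇒≥ w₁≮w₂) =
      sym (ℤ.+-inverseʳ (signed s w₂))

excess-combine : (x : Vector Bool n) (e₁ e₂ : Eqn n) → α e₁ ≡ α e₂ →
                 excess x (combine e₁ e₂) ≡ contribution x e₁ +ℤ contribution x e₂
excess-combine x (eqn a true  w₁) (eqn .a true  w₂) refl =
  trans (ℤ.+-identityʳ _) (signed-+ (satisfies x (eqn a true w₁)) w₁ w₂)
excess-combine x (eqn a false w₁) (eqn .a false w₂) refl =
  trans (ℤ.+-identityʳ _) (signed-+ (satisfies x (eqn a false w₁)) w₁ w₂)
excess-combine x (eqn a true  w₁) (eqn .a false w₂) refl = excess-combineOpposite x a true w₁ w₂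
excess-combine x (eqn a false w₁) (eqn .a true  w₂) refl = excess-combineOpposite x a false w₁ w₂

excess-CombineStep : (x : Vector Bool n) {S T : System n} → CombineStep S T →
                     excess x S ≡ excess x T
excess-CombineStep x (combineStep {S} {e₁} {e₂} {rest} S↭ α₁≡α₂) = begin
  excess x S
    ≡⟨ excess-↭ x S↭ ⟩
  contribution x e₁ +ℤ (contribution x e₂ +ℤ excess x rest)
    ≡⟨ ℤ.+-assoc (contribution x e₁) (contribution x e₂) (excess x rest) ⟨
  (contribution x e₁ +ℤ contribution x e₂) +ℤ excess x rest
    ≡⟨ cong (_+ℤ excess x rest) (excess-combine x e₁ e₂ α₁≡α₂) ⟨
  excess x (combine e₁ e₂) +ℤ excess x rest
    ≡⟨ excess-++ x (combine e₁ e₂) rest ⟨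
  excess x (combine e₁ e₂ ++ rest) ∎
  where open ≡-Reasoning

excess-Star : (x : Vector Bool n) {S T : System n} → Star CombineStep S T →
              excess x S ≡ excess x T
excess-Star x = fold (λ S T → excess x S ≡ excess x T) (trans ∘ excess-CombineStep x) refl

PositiveWith : (Subset n → Set) → Eqn n → Set
PositiveWith Q e = 0 < w e × Q (α e)

WellFormed : Eqn n → Set
WellFormed = PositiveWith Nonempty

combineOpposite-PositiveWith : (Q : Subset n → Set) {a : Subset n} (c : Bool) (w₁ w₂ : ℕ) →
                               Q a → All (PositiveWith Q) (combineOpposite a c w₁ w₂)
combineOpposite-PositiveWith Q c w₁ w₂ qa with w₂ <ᵇ w₁ | ℕ.<ᵇ-reflects-< w₂ w₁
... | true  | ofʸ w₂<w₁ = (ℕ.m<n⇒0<n∸m w₂<w₁ , qa) ∷ []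
... | false | ofⁿ _ with w₁ <ᵇ w₂ | ℕ.<ᵇ-reflects-< w₁ w₂
...   | true  | ofʸ w₁<w₂ = (ℕ.m<n⇒0<n∸m w₁<w₂ , qa) ∷ []
...   | false | ofⁿ _     = []

combine-PositiveWith : (Q : Subset n → Set) (e₁ e₂ : Eqn n) →
                       PositiveWith Q e₁ → All (PositiveWith Q) (combine e₁ e₂)
combine-PositiveWith Q (eqn a true  w₁) (eqn _ true  w₂) (0<w₁ , qa) =
  (ℕ.<-≤-trans 0<w₁ (ℕ.m≤m+n w₁ w₂) , qa) ∷ []
combine-PositiveWith Q (eqn a false w₁) (eqn _ false w₂) (0<w₁ , qa) =
  (ℕ.<-≤-trans 0<w₁ (ℕ.m≤m+n w₁ w₂) , qa) ∷ []
combine-PositiveWith Q (eqn a true  w₁) (eqn _ false w₂) (_ , qa) =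
  combineOpposite-PositiveWith Q true w₁ w₂ qa
combine-PositiveWith Q (eqn a false w₁) (eqn _ true  w₂) (_ , qa) =
  combineOpposite-PositiveWith Q false w₁ w₂ qa

All-PositiveWith-Star : (Q : Subset n → Set) {S T : System n} → Star CombineStep S T →
                        All (PositiveWith Q) S → All (PositiveWith Q) T
All-PositiveWith-Star Q =
  fold (λ S T → All (PositiveWith Q) S → All (PositiveWith Q) T) preserve id
  where
  preserve : ∀ {S T U} → CombineStep S T →
             (All (PositiveWith Q) T → All (PositiveWith Q) U) →
             All (PositiveWith Q) S → All (PositiveWith Q) U
  preserve (combineStep {e₁ = e₁} {e₂} S↭ _) k qs with All-resp-↭ S↭ qs
  ... | q₁ ∷ _ ∷ qs′ = k (++⁺ (combine-PositiveWith Q e₁ e₂ q₁) qs′)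

Nonempty-Δ : {a a′ : Subset n} → a ≢ a′ → Nonempty (a Δ a′)
Nonempty-Δ {a = []}        {[]}         a≢a′ = contradiction refl a≢a′
Nonempty-Δ {a = true ∷ a}  {true ∷ a′}  a≢a′ =
  Product.map suc there (Nonempty-Δ (a≢a′ ∘ cong (true ∷_)))
Nonempty-Δ {a = false ∷ a} {false ∷ a′} a≢a′ =
  Product.map suc there (Nonempty-Δ (a≢a′ ∘ cong (false ∷_)))
Nonempty-Δ {a = true ∷ _}  {false ∷ _}  _    = zero , here
Nonempty-Δ {a = false ∷ _} {true ∷ _}   _    = zero , here

NonemptyWithout : Fin n → Subset n → Set
NonemptyWithout l a = Nonempty a × lookup a l ≡ false

eliminate-NonemptyWithout : (l : Fin n) (e e′ : Eqn n) → occurs l e ≡ true → α e ≢ α e′ →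
                            WellFormed e′ → PositiveWith (NonemptyWithout l) (eliminate l e e′)
eliminate-NonemptyWithout l e e′ l∈e α≢α′ (0<w′ , nonempty′) with occurs l e′ in l∈?e′
... | true  = 0<w′ , Nonempty-Δ α≢α′ ,
              trans (lookup-zipWith _xor_ l (α e) (α e′)) (cong₂ _xor_ l∈e l∈?e′)
... | false = 0<w′ , nonempty′ , l∈?e′

Irreducible-↭-head : {S rest : System n} {e : Eqn n} → Irreducible S → S ↭ e ∷ rest →
                     All (λ e′ → α e ≢ α e′) rest
Irreducible-↭-head irr S↭ =
  AllPairs.head (AllPairs-resp-↭ ≢-sym (resp₂ (λ e e′ → α e ≢ α e′)) (↭⇒↭ₛ S↭) irr)
  where open PermutationProperties (setoid (Eqn _)) using (AllPairs-resp-↭)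

excess-flipAt-unoccurring : (l : Fin n) (x : Vector Bool n) (S : System n) →
                            All (λ e → occurs l e ≡ false) S →
                            excess (flipAt l x) S ≡ excess x S
excess-flipAt-unoccurring l x []      []          = refl
excess-flipAt-unoccurring l x (e ∷ S) (l∉e ∷ l∉S) =
  cong₂ _+ℤ_ (cong (λ s → signed s (w e)) (satisfies-flipAt-unoccurring l x e l∉e))
             (excess-flipAt-unoccurring l x S l∉S)

satisfying-assignment : (l : Fin n) (e : Eqn n) (S : System n) → occurs l e ≡ true →
                        All (λ e′ → occurs l e′ ≡ false) S → (x : Vector Bool n) →
                        ∃ λ y → satisfies y e ≡ true × excess y S ≡ excess x S
satisfying-assignment l e S l∈e l∉S x with satisfies x e in x-e
... | true  = x , x-e , refl
... | false = flipAt l x , trans (satisfies-flipAt l x e l∈e) (cong not x-e) ,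
              excess-flipAt-unoccurring l x S l∉S

excess-eliminate : (y : Vector Bool n) (l : Fin n) (e : Eqn n) (rest : System n) →
                   satisfies y e ≡ true → excess y (map (eliminate l e) rest) ≡ excess y rest
excess-eliminate y l e []          e-holds = refl
excess-eliminate y l e (e′ ∷ rest) e-holds =
  cong₂ _+ℤ_ contribution-eliminate (excess-eliminate y l e rest e-holds)
  where
  contribution-eliminate : contribution y (eliminate l e e′) ≡ contribution y e′
  contribution-eliminate with satisfies-eliminate y l e e′ e-holds
  ... | same with occurs l e′
  ...   | true  = cong (λ s → signed s (w e′)) same
  ...   | false = refl

excess-AStep : (y : Vector Bool n) (l : Fin n) {e : Eqn n} {S rest S′ : System n} →
               satisfies y e ≡ true → S ↭ e ∷ rest →
               Star CombineStep (map (eliminate l e) rest) S′ →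
               excess y S ≡ + w e +ℤ excess y S′
excess-AStep y l {e} {S} {rest} {S′} e-holds S↭ combining = begin
  excess y S
    ≡⟨ excess-↭ y S↭ ⟩
  signed (satisfies y e) (w e) +ℤ excess y rest
    ≡⟨ cong₂ _+ℤ_ (cong (λ s → signed s (w e)) e-holds)
                  (sym (excess-eliminate y l e rest e-holds)) ⟩
  + w e +ℤ excess y (map (eliminate l e) rest)
    ≡⟨ cong (+ w e +ℤ_) (excess-Star y combining) ⟩
  + w e +ℤ excess y S′ ∎
  where open ≡-Reasoning

AStep-invariant : {l : Fin n} {e : Eqn n} {S rest S′ : System n} →
                  All WellFormed S → Irreducible S → S ↭ e ∷ rest → occurs l e ≡ true →
                  Star CombineStep (map (eliminate l e) rest) S′ →
                  All (PositiveWith (NonemptyWithout l)) S′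
AStep-invariant {l = l} {e} wf irr S↭ l∈e combining =
  All-PositiveWith-Star (NonemptyWithout l) combining
    (map⁺ (All.zipWith (λ (α≢ , wf′) → eliminate-NonemptyWithout l e _ l∈e α≢ wf′)
                       (Irreducible-↭-head irr S↭ , All.tail (All-resp-↭ S↭ wf))))

-- Conditional expectations

isEmpty : Subset n → Bool
isEmpty []      = true
isEmpty (p ∷ a) = not p ∧ isEmpty a

isEmpty-Nonempty : {a : Subset n} → Nonempty a → isEmpty a ≡ false
isEmpty-Nonempty {a = true ∷ _}  _                   = refl
isEmpty-Nonempty {a = false ∷ _} (suc i , there i∈a) = isEmpty-Nonempty (i , i∈a)

-- An equation 0 = c contributes the same amount to the excess of every assignment.
constantContribution : Eqn n → ℤ
constantContribution e = if isEmpty (α e) then signed (not (b e)) (w e) else 0ℤ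

constantPart : System n → ℤ
constantPart []      = 0ℤ
constantPart (e ∷ S) = constantContribution e +ℤ constantPart S

constantPart-WellFormed : (S : System n) → All WellFormed S → constantPart S ≡ 0ℤ
constantPart-WellFormed []      []                    = refl
constantPart-WellFormed (e ∷ S) ((_ , nonempty) ∷ wf)
  rewrite isEmpty-Nonempty nonempty | constantPart-WellFormed S wf = refl

excess≡constantPart : (x : Vector Bool 0) (S : System 0) → excess x S ≡ constantPart S
excess≡constantPart x []                   = refl
excess≡constantPart x (eqn [] true v ∷ S)  = cong (- + v +ℤ_) (excess≡constantPart x S)
excess≡constantPart x (eqn [] false v ∷ S) = cong (+ v +ℤ_) (excess≡constantPart x S)

restrict : Bool → Eqn (suc n) → Eqn n
restrict y (eqn (p ∷ a) c v) = eqn a ((p ∧ y) xor c) v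

excess-restrict : (y : Bool) (x : Vector Bool n) (S : System (suc n)) →
                  excess (y Vector.∷ x) S ≡ excess x (map (restrict y) S)
excess-restrict y x []                    = refl
excess-restrict y x (eqn (p ∷ a) c v ∷ S) =
  cong₂ _+ℤ_ (cong (λ u → signed (holds u) v) (xor-rotate (p ∧ y) (lhs x a) c))
             (excess-restrict y x S)

constantContribution-restrict : (e : Eqn (suc n)) →
  constantContribution (restrict true e) +ℤ constantContribution (restrict false e) ≡
  constantContribution e +ℤ constantContribution e
constantContribution-restrict (eqn (false ∷ a) c v) = refl
constantContribution-restrict (eqn (true ∷ a) c v) with isEmpty a
... | false = refl
constantContribution-restrict (eqn (true ∷ a) true  v) | true = ℤ.+-inverseʳ (+ v)
constantContribution-restrict (eqn (true ∷ a) false v) | true = ℤ.+-inverseˡ (+ v)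

constantPart-restrict : (S : System (suc n)) →
  constantPart (map (restrict true) S) +ℤ constantPart (map (restrict false) S) ≡
  constantPart S +ℤ constantPart S
constantPart-restrict []      = refl
constantPart-restrict (e ∷ S) = begin
  (c₁ +ℤ P₁) +ℤ (c₀ +ℤ P₀)
    ≡⟨ +-interchange c₁ P₁ c₀ P₀ ⟩
  (c₁ +ℤ c₀) +ℤ (P₁ +ℤ P₀)
    ≡⟨ cong₂ _+ℤ_ (constantContribution-restrict e) (constantPart-restrict S) ⟩
  (c +ℤ c) +ℤ (P +ℤ P)
    ≡⟨ +-interchange c P c P ⟨
  (c +ℤ P) +ℤ (c +ℤ P) ∎
  where
  open ≡-Reasoning
  c  = constantContribution e
  c₁ = constantContribution (restrict true e)
  c₀ = constantContribution (restrict false e)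
  P  = constantPart S
  P₁ = constantPart (map (restrict true) S)
  P₀ = constantPart (map (restrict false) S)

+-cancelˡ-≤ : ∀ k {i j} → k +ℤ i ≤ℤ k +ℤ j → i ≤ℤ j
+-cancelˡ-≤ k {i} {j} k+i≤k+j = begin
  i               ≡⟨ \\-leftDividesʳ k i ⟨
  - k +ℤ (k +ℤ i) ≤⟨ ℤ.+-monoʳ-≤ (- k) k+i≤k+j ⟩
  - k +ℤ (k +ℤ j) ≡⟨ \\-leftDividesʳ k j ⟩
  j               ∎
  where open ℤ.≤-Reasoning

i+j≡k+k⇒k≤i⊎k≤j : ∀ {i j k} → i +ℤ j ≡ k +ℤ k → k ≤ℤ i ⊎ k ≤ℤ j
i+j≡k+k⇒k≤i⊎k≤j {i} {j} {k} i+j≡k+k with ℤ.≤-total k i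
... | inj₁ k≤i = inj₁ k≤i
... | inj₂ i≤k = inj₂ (+-cancelˡ-≤ k (begin
  k +ℤ k ≡⟨ i+j≡k+k ⟨
  i +ℤ j ≤⟨ ℤ.+-monoˡ-≤ j i≤k ⟩
  k +ℤ j ∎))
  where open ℤ.≤-Reasoning

constantPart≤excess : ∀ n (S : System n) → ∃ λ x → constantPart S ≤ℤ excess x S
constantPart≤excess zero    S = (λ ()) , ℤ.≤-reflexive (sym (excess≡constantPart (λ ()) S))
constantPart≤excess (suc n) S =
  [ extend true , extend false ]′ (i+j≡k+k⇒k≤i⊎k≤j (constantPart-restrict S))
  where
  extend : ∀ y → constantPart S ≤ℤ constantPart (map (restrict y) S) →
           ∃ λ x → constantPart S ≤ℤ excess x S
  extend y ≤restricted with constantPart≤excess n (map (restrict y) S)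
  ... | x , bound = y Vector.∷ x ,
    ℤ.≤-trans ≤restricted (ℤ.≤-trans bound (ℤ.≤-reflexive (sym (excess-restrict y x S))))

AStep-WellFormed : {S S′ : System n} → AStep S S′ → All WellFormed S → Irreducible S →
                   All WellFormed S′
AStep-WellFormed (aStep l e rest _ _ l∈e S↭ (combining , _)) wf irr =
  All.map (Product.map₂ proj₁) (AStep-invariant wf irr S↭ ([]=⇒lookup l∈e) combining)

AStep-gain : {S S′ : System n} → AStep S S′ → All WellFormed S → Irreducible S →
             (x : Vector Bool n) → ∃ λ y → + 1 +ℤ excess x S′ ≤ℤ excess y S
AStep-gain {S = S} {S′} (aStep l e rest _ _ l∈e S↭ (combining , _)) wf irr x
  with satisfying-assignment l e S′ ([]=⇒lookup l∈e)
         (All.map (proj₂ ∘ proj₂) (AStep-invariant wf irr S↭ ([]=⇒lookup l∈e) combining)) x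
... | y , e-holds , y≡x = y , (begin
  + 1 +ℤ excess x S′   ≤⟨ ℤ.+-monoˡ-≤ (excess x S′) (+≤+ 0<w) ⟩
  + w e +ℤ excess x S′ ≡⟨ cong (+ w e +ℤ_) y≡x ⟨
  + w e +ℤ excess y S′ ≡⟨ excess-AStep y l e-holds S↭ combining ⟨
  excess y S           ∎)
  where
  open ℤ.≤-Reasoning
  0<w : 0 < w e
  0<w = proj₁ (All.head (All-resp-↭ S↭ wf))

ASteps⇒excess : ∀ k {S S″ : System n} → ASteps k S S″ → All WellFormed S → Irreducible S →
                ∃ λ x → + k ≤ℤ excess x S
ASteps⇒excess zero {S} done wf _ with constantPart≤excess _ S
... | x , bound = x , ℤ.≤-trans (ℤ.≤-reflexive (sym (constantPart-WellFormed S wf))) bound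
ASteps⇒excess (suc k) (step s@(aStep _ _ _ _ _ _ _ (_ , irr′)) steps) wf irr
  with ASteps⇒excess k steps (AStep-WellFormed s wf irr) irr′
... | x , k≤x with AStep-gain s wf irr x
...   | y , gain = y , ℤ.≤-trans (ℤ.+-monoʳ-≤ (+ 1) k≤x) gain

ValidInstance⇒WellFormed : {r : ℕ → ℕ} {S : System n} → ValidInstance r n S → All WellFormed S
ValidInstance⇒WellFormed valid = All.zipWith id (posWeights , nonemptySets)
  where open ValidInstance valid

lemma2 : (r : ℕ → ℕ) (n : ℕ) (S : System n) (k : ℕ) →
    ValidInstance r n S → Irreducible S →
    (S′ : System n) → ASteps k S S′ → YesInstance S k
lemma2 r n S k valid irr S′ steps
  with ASteps⇒excess k steps (ValidInstance⇒WellFormed valid) irr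
... | x , k≤excess = x , ℤ.drop‿+≤+ (begin
  + (totalWeight S + k)             ≤⟨ ℤ.+-monoʳ-≤ (+ totalWeight S) k≤excess ⟩
  + totalWeight S +ℤ excess x S     ≡⟨ totalWeight+excess x S ⟩
  + (satWeight x S + satWeight x S) ≡⟨ cong (λ m → + (satWeight x S + m)) (ℕ.+-identityʳ _) ⟨
  + (2 * satWeight x S)             ∎)
  where open ℤ.≤-Reasoning
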